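{- Let $k\ge2$ be an integer. Suppose there exist two disjoint Hadamard $2$-$(4k-1,2k-1,k-1)$ designs on the same point set. Then there exists a tight $\mathrm{PTE}_{4k-1}$ solution of degree $2$ for the binary sphere $\Omega=S_{2k-1}^{4k-2}$.
   Context: A $2$-$(v,\kappa,\lambda)$ design is a pair $(R,\mathcal{B})$ where $R$ is a set of $v$ points and $\mathcal{B}$ is a collection of $\kappa$-element subsets of $R$ (blocks) such that every $2$-element subset of $R$ is contained in exactly $\lambda$ blocks; a $2$-$(4k-1,2k-1,k-1)$ design is called a Hadamard $2$-design. Two designs $(R,\mathcal{B}_1)$, $(R,\mathcal{B}_2)$ are disjoint if $\mathcal{B}_1\cap\mathcal{B}_2=\emptyset$. The binary sphere is $S_k^{r-1}=\{(x_1,\ldots,x_r)\in\{0,1\}^r:\sum x_i^2=k\}$. For multisets $A=\{\mathbf{a}_1,\ldots,\mathbf{a}_n\}$, $B=\{\mathbf{b}_1,\ldots,\mathbf{b}_n\}\subset\mathbb{Q}^r$ with $\mathbf{a}_i=(a_{i1},\ldots,a_{ir})$, $\mathbf{b}_i=(b_{i1},\ldots,b_{ir})$, $(A,B)$ is a $\mathrm{PTE}_r$ solution of degree $m$ and size $n$ if $A,B$ have no common element and $\sum_i\prod_j a_{ij}^{k_j}=\sum_i\prod_j b_{ij}^{k_j}$ for all nonnegative integers $k_j$ with $1\le\sum_j k_j\le m$. For $\Omega\subseteq\mathbb{Q}^r$, $\mathcal{P}_t(\Omega)$ is the $\mathbb{Q}$-space of restrictions to $\Omega$ of rational polynomials of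 degree $\le t$; given a basis $\mathbf{t}_1,\ldots,\mathbf{t}_d$ of it, $N_A=(\mathbf{t}_i(\mathbf{a}_j))$ and $N_B=(\mathbf{t}_i(\mathbf{b}_j))$. A $\mathrm{PTE}_r$ solution $(A,B)$ with $A,B\subseteq\Omega$ of degree $2t$ and size $n$ is tight (for $\Omega$) if $n=\operatorname{rank}[N_A\;N_B]=\dim_{\mathbb{Q}}\mathcal{P}_t(\Omega)$. -}

module Defs where

open import Data.Nat as ℕ using (ℕ; zero; suc; _≤_)
open import Data.Bool using (Bool; true; false; _∧_)
open import Data.Fin using (Fin; splitAt)
open import Data.Fin.Subset using (Subset; ∣_∣)
open import Data.Vec using (lookup)
open import Data.List using (List; []; _∷_)
open import Data.List.Relation.Unary.All using (All)
open import Data.List.Membership.Propositional using (_∈_)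
open import Data.Rational using (ℚ; 0ℚ; 1ℚ; _+_; _*_)
open import Data.Product using (Σ; _×_; _,_; ∃)
open import Data.Sum using ([_,_])
open import Relation.Binary.PropositionalEquality using (_≡_; _≢_)
open import Relation.Nullary using (¬_)
open import Data.Empty using (⊥)
import Data.Integer
import Data.Rational
import Data.Sum

∑ℕ : ∀ {n} → (Fin n → ℕ) → ℕ
∑ℕ {zero}  f = 0
∑ℕ {suc n} f = f Fin.zero ℕ.+ ∑ℕ (λ i → f (Fin.suc i))

∑ : ∀ {n} → (Fin n → ℚ) → ℚ
∑ {zero}  f = 0ℚ
∑ {suc n} f = f Fin.zero + ∑ (λ i → f (Fin.suc i))

∏ : ∀ {n} → (Fin n → ℚ) → ℚ
∏ {zero}  f = 1ℚ
∏ {suc n} f = f Fin.zero * ∏ (λ i → f (Fin.suc i))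

_^_ : ℚ → ℕ → ℚ
x ^ zero  = 1ℚ
x ^ suc m = x * (x ^ m)

countPair : ∀ {v} → Fin v → Fin v → List (Subset v) → ℕ
countPair x y [] = 0
countPair x y (b ∷ bs) with lookup b x ∧ lookup b y
... | true  = suc (countPair x y bs)
... | false = countPair x y bs

Is2Design : (v κ λ′ : ℕ) → List (Subset v) → Set
Is2Design v κ λ′ ℬ =
  All (λ b → ∣ b ∣ ≡ κ) ℬ ×
  (∀ (x y : Fin v) → x ≢ y → countPair x y ℬ ≡ λ′)

IsHadamard2Design : (k : ℕ) → List (Subset (4 ℕ.* k ℕ.∸ 1)) → Set
IsHadamard2Design k ℬ = Is2Design (4 ℕ.* k ℕ.∸ 1) (2 ℕ.* k ℕ.∸ 1) (k ℕ.∸ 1) ℬ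

DisjointDesigns : ∀ {v} → List (Subset v) → List (Subset v) → Set
DisjointDesigns ℬ₁ ℬ₂ = ∀ b → b ∈ ℬ₁ → b ∈ ℬ₂ → ⊥

Point : ℕ → Set
Point r = Fin r → ℚ

BinarySphere : (r κ : ℕ) → Point r → Set
BinarySphere r κ x =
  (∀ i → (x i ≡ 0ℚ) Data.Sum.⊎ (x i ≡ 1ℚ)) ×
  (∑ (λ i → x i ^ 2) ≡ (Data.Integer.+ κ) Data.Rational./ 1)

-- PTE_r solutions; multisets of size n are families Fin n → Point r

Exponent : ℕ → Set
Exponent r = Fin r → ℕ

monomial : ∀ {r} → Exponent r → Point r → ℚ
monomial e x = ∏ (λ j → x j ^ e j)

IsPTE : (r m n : ℕ) → (A B : Fin n → Point r) → Set
IsPTE r m n A B =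
  (∀ (i j : Fin n) → ¬ (∀ l → A i l ≡ B j l)) ×
  (∀ (e : Exponent r) → 1 ≤ ∑ℕ e → ∑ℕ e ≤ m →
     ∑ (λ i → monomial e (A i)) ≡ ∑ (λ i → monomial e (B i)))

Poly : ℕ → Set
Poly r = List (ℚ × Exponent r)

eval : ∀ {r} → Poly r → Point r → ℚ
eval []             x = 0ℚ
eval ((c , e) ∷ ps) x = c * monomial e x + eval ps x

DegreeAtMost : ∀ {r} → ℕ → Poly r → Set
DegreeAtMost t p = All (λ ce → ∑ℕ (Data.Product.proj₂ ce) ≤ t) p

IsBasisP : (r t : ℕ) (Ω : Point r → Set) (d : ℕ) → (Fin d → Poly r) → Set
IsBasisP r t Ω d ts =
  (∀ i → DegreeAtMost t (ts i)) ×
  (∀ (c : Fin d → ℚ) →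
     (∀ x → Ω x → ∑ (λ i → c i * eval (ts i) x) ≡ 0ℚ) →
     ∀ i → c i ≡ 0ℚ) ×
  (∀ (p : Poly r) → DegreeAtMost t p →
     Σ (Fin d → ℚ) λ c → ∀ x → Ω x → eval p x ≡ ∑ (λ i → c i * eval (ts i) x))

IndependentColumns : ∀ {d m ρ} → (Fin d → Fin m → ℚ) → (Fin ρ → Fin m) → Set
IndependentColumns {d} {m} {ρ} M σ =
  ∀ (c : Fin ρ → ℚ) → (∀ row → ∑ (λ l → c l * M row (σ l)) ≡ 0ℚ) → ∀ l → c l ≡ 0ℚ

HasRank : ∀ {d m} → (Fin d → Fin m → ℚ) → ℕ → Set
HasRank {d} {m} M ρ =
  (Σ (Fin ρ → Fin m) λ σ → IndependentColumns M σ) ×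
  (∀ (σ : Fin (suc ρ) → Fin m) → ¬ IndependentColumns M σ)

NAB : ∀ {r d n} → (Fin d → Poly r) → (A B : Fin n → Point r) →
      Fin d → Fin (n ℕ.+ n) → ℚ
NAB {n = n} ts A B i j = eval (ts i) ([ A , B ] (splitAt n j))

IsTightPTE : (r t : ℕ) (Ω : Point r → Set) (n : ℕ) (A B : Fin n → Point r) → Set
IsTightPTE r t Ω n A B =
  IsPTE r (2 ℕ.* t) n A B ×
  (∀ i → Ω (A i)) × (∀ i → Ω (B i)) ×
  (Σ ℕ λ d → Σ (Fin d → Poly r) λ ts →
     IsBasisP r t Ω d ts × n ≡ d × HasRank (NAB ts A B) n)

{-# OPTIONS --safe #-}
-- The points of A and B are the columns of the incidence matrices N₁, N₂ of the two designs.
-- A 2-(4k−1, 2k−1, k−1) design is symmetric (κ(κ − 1) = λ(v − 1) forces r = κ and b = v), so each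
-- Nᵢ is a square 0/1 matrix with row sums κ and Nᵢ Nᵢᵀ = λJ + (κ − λ)I. Row sums and Nᵢ Nᵢᵀ are the
-- first and second moments of the columns, so (A, B) is a PTE solution of degree 2 on S_κ, and
-- disjointness of the designs makes A and B disjoint. On S_κ we have xᵢ² = xᵢ and 1 = (Σ xᵢ)/κ, so the
-- coordinates xᵢ span 𝒫₁(S_κ). Since Nᵢ(κNᵢᵀ − λJ) = κ(κ − λ)I, the matrix N₁ is invertible: the
-- coordinates are independent on its columns, and these columns give rank [N_A N_B] ≥ v, while any
-- v + 1 vectors in ℚᵛ are dependent.
module Submission where

open import Defs
open import Algebra.Bundles using (CommutativeRing)
open import Data.Empty using (⊥-elim)
open import Data.Fin using (Fin; zero; suc; punchIn; cast; _↑ˡ_)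
import Data.Fin.Properties as Finₚ
import Data.Integer as ℤ
import Data.Integer.Properties as ℤₚ
open import Data.Nat as ℕ using (ℕ; zero; suc; _≤_; s≤s)
import Data.Nat.Properties as ℕₚ
open import Data.Product using (Σ; _,_)
open import Data.Rational using (ℚ; 0ℚ; 1ℚ; toℚᵘ; _≟_)
import Data.Rational.Properties as ℚₚ
open import Data.Rational.Unnormalised as ℚᵘ using (mkℚᵘ; *≡*) renaming (_≃_ to _≃ᵘ_)
import Data.Rational.Unnormalised.Properties as ℚᵘₚ
open import Data.Sum using (_⊎_; inj₁; inj₂; [_,_])
open import Function using (_∘_; id)
open import Level using (0ℓ)
open import Relation.Binary.PropositionalEquality
  using (_≡_; _≢_; _≗_; refl; sym; trans; cong; cong₂; subst; module ≡-Reasoning)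
open import Relation.Nullary using (¬_; yes; no)
open import Relation.Nullary.Decidable using (decidable-stable; dec⇒maybe)
open import Tactic.RingSolver using (solve-∀)
open import Tactic.RingSolver.Core.AlmostCommutativeRing using (AlmostCommutativeRing; fromCommutativeRing)

module Arithmetic where
  open import Data.Rational using (_+_; _*_; _-_; _/_)
  open import Algebra.Apartness.Properties.HeytingCommutativeRing ℚₚ.heytingCommutativeRing using (x#0y#0→xy#0) public
  open import Algebra.Properties.Group ℚₚ.+-0-group using (x∙y⁻¹≈ε⇒x≈y)
  open ≡-Reasoning

  ℚ-ring : AlmostCommutativeRing 0ℓ 0ℓ
  ℚ-ring = fromCommutativeRing ℚₚ.+-*-commutativeRing (λ x → dec⇒maybe (0ℚ ≟ x))

  fromℕ : ℕ → ℚ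
  fromℕ n = (ℤ.+ n) / 1

  toℚᵘ-fromℕ : ∀ n → toℚᵘ (fromℕ n) ≃ᵘ mkℚᵘ (ℤ.+ n) 0
  toℚᵘ-fromℕ n = ℚₚ.toℚᵘ-fromℚᵘ (mkℚᵘ (ℤ.+ n) 0)

  -- `+ n / 1` is normalised by a gcd computation, so its arithmetic is checked on unnormalised rationals.
  fromℕ-suc : ∀ n → fromℕ (suc n) ≡ 1ℚ + fromℕ n
  fromℕ-suc n = ℚₚ.toℚᵘ-injective (ℚᵘₚ.≃-trans (toℚᵘ-fromℕ (suc n)) (ℚᵘₚ.≃-trans 1+n≃
    (ℚᵘₚ.≃-sym (ℚᵘₚ.≃-trans (ℚₚ.toℚᵘ-homo-+ 1ℚ (fromℕ n))
                              (ℚᵘₚ.+-congʳ (toℚᵘ 1ℚ) (toℚᵘ-fromℕ n))))))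
    where
    1+n≃ : mkℚᵘ (ℤ.+ suc n) 0 ≃ᵘ mkℚᵘ (ℤ.+ 1) 0 ℚᵘ.+ mkℚᵘ (ℤ.+ n) 0
    1+n≃ = *≡* (trans (ℤₚ.*-identityʳ _)
                      (sym (trans (ℤₚ.*-identityʳ _) (cong (λ z → (ℤ.+ 1) ℤ.+ z) (ℤₚ.*-identityʳ (ℤ.+ n))))))

  fromℕ-+ : ∀ m n → fromℕ (m ℕ.+ n) ≡ fromℕ m + fromℕ n
  fromℕ-+ zero    n = sym (ℚₚ.+-identityˡ (fromℕ n))
  fromℕ-+ (suc m) n = begin
    fromℕ (suc (m ℕ.+ n))       ≡⟨ fromℕ-suc (m ℕ.+ n) ⟩
    1ℚ + fromℕ (m ℕ.+ n)        ≡⟨ cong (1ℚ +_) (fromℕ-+ m n) ⟩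
    1ℚ + (fromℕ m + fromℕ n)    ≡⟨ ℚₚ.+-assoc 1ℚ (fromℕ m) (fromℕ n) ⟨
    1ℚ + fromℕ m + fromℕ n      ≡⟨ cong (_+ fromℕ n) (fromℕ-suc m) ⟨
    fromℕ (suc m) + fromℕ n     ∎

  fromℕ-* : ∀ m n → fromℕ (m ℕ.* n) ≡ fromℕ m * fromℕ n
  fromℕ-* zero    n = sym (ℚₚ.*-zeroˡ (fromℕ n))
  fromℕ-* (suc m) n = begin
    fromℕ (n ℕ.+ m ℕ.* n)             ≡⟨ fromℕ-+ n (m ℕ.* n) ⟩
    fromℕ n + fromℕ (m ℕ.* n)         ≡⟨ cong (fromℕ n +_) (fromℕ-* m n) ⟩
    fromℕ n + fromℕ m * fromℕ n       ≡⟨ cong (_+ fromℕ m * fromℕ n) (ℚₚ.*-identityˡ (fromℕ n)) ⟨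
    1ℚ * fromℕ n + fromℕ m * fromℕ n  ≡⟨ ℚₚ.*-distribʳ-+ (fromℕ n) 1ℚ (fromℕ m) ⟨
    (1ℚ + fromℕ m) * fromℕ n          ≡⟨ cong (_* fromℕ n) (fromℕ-suc m) ⟨
    fromℕ (suc m) * fromℕ n           ∎

  fromℕ-injective : ∀ {m n} → fromℕ m ≡ fromℕ n → m ≡ n
  fromℕ-injective {m} {n} eq with ℚᵘₚ.≃-trans (ℚᵘₚ.≃-sym (toℚᵘ-fromℕ m))
                                    (ℚᵘₚ.≃-trans (ℚᵘₚ.≃-reflexive (cong toℚᵘ eq)) (toℚᵘ-fromℕ n))
  ... | *≡* m≡n = ℤₚ.+-injective (trans (sym (ℤₚ.*-identityʳ (ℤ.+ m))) (trans m≡n (ℤₚ.*-identityʳ (ℤ.+ n))))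

  fromℕ-≢0 : ∀ {n} → 0 ℕ.< n → fromℕ n ≢ 0ℚ
  fromℕ-≢0 0<n = ℕₚ.>⇒≢ 0<n ∘ fromℕ-injective

  fromℕ-≢ : ∀ {m n} → m ≢ n → fromℕ m - fromℕ n ≢ 0ℚ
  fromℕ-≢ m≢n = m≢n ∘ fromℕ-injective ∘ x∙y⁻¹≈ε⇒x≈y _ _

  ab≡0⇒b≡0 : ∀ {a b} → a ≢ 0ℚ → a * b ≡ 0ℚ → b ≡ 0ℚ
  ab≡0⇒b≡0 {b = b} a≢0 ab≡0 = decidable-stable (b ≟ 0ℚ) (λ b≢0 → x#0y#0→xy#0 a≢0 b≢0 ab≡0)

  *-cancelʳ-≡ : ∀ {a b c} → c ≢ 0ℚ → a * c ≡ b * c → a ≡ b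
  *-cancelʳ-≡ {a} {b} {c} c≢0 ac≡bc = x∙y⁻¹≈ε⇒x≈y a b (ab≡0⇒b≡0 c≢0 (begin
    c * (a - b)        ≡⟨ expand c a b ⟩
    a * c - b * c      ≡⟨ cong (_- b * c) ac≡bc ⟩
    b * c - b * c      ≡⟨ ℚₚ.+-inverseʳ (b * c) ⟩
    0ℚ                 ∎))
    where
    expand : ∀ c a b → c * (a - b) ≡ a * c - b * c
    expand = solve-∀ ℚ-ring

module Sums where
  open import Data.Rational using (_+_; _*_)
  open import Algebra.Properties.Semiring.Sum (CommutativeRing.semiring ℚₚ.+-*-commutativeRing) as Sum using (sum)
  open Arithmetic
  open ≡-Reasoning

  ∑≡sum : ∀ {n} (f : Fin n → ℚ) → ∑ f ≡ sum f
  ∑≡sum {zero}  f = refl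
  ∑≡sum {suc n} f = cong (f zero +_) (∑≡sum (f ∘ suc))

  ∑-cong : ∀ {n} {f g : Fin n → ℚ} → f ≗ g → ∑ f ≡ ∑ g
  ∑-cong {f = f} {g} f≗g = trans (∑≡sum f) (trans (Sum.sum-cong-≗ f≗g) (sym (∑≡sum g)))

  ∑-distrib-+ : ∀ {n} (f g : Fin n → ℚ) → ∑ (λ i → f i + g i) ≡ ∑ f + ∑ g
  ∑-distrib-+ f g = trans (∑≡sum (λ i → f i + g i))
                          (trans (Sum.∑-distrib-+ f g) (sym (cong₂ _+_ (∑≡sum f) (∑≡sum g))))

  ∑-comm : ∀ {m n} (f : Fin m → Fin n → ℚ) → ∑ (λ i → ∑ (f i)) ≡ ∑ (λ j → ∑ (λ i → f i j))
  ∑-comm f = begin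
    ∑ (λ i → ∑ (f i))                ≡⟨ ∑-cong (λ i → ∑≡sum (f i)) ⟩
    ∑ (λ i → sum (f i))              ≡⟨ ∑≡sum (λ i → sum (f i)) ⟩
    sum (λ i → sum (f i))            ≡⟨ Sum.∑-comm f ⟩
    sum (λ j → sum (λ i → f i j))    ≡⟨ ∑≡sum (λ j → sum (λ i → f i j)) ⟨
    ∑ (λ j → sum (λ i → f i j))      ≡⟨ ∑-cong (λ j → ∑≡sum (λ i → f i j)) ⟨
    ∑ (λ j → ∑ (λ i → f i j))        ∎

  *-distribˡ-∑ : ∀ {n} a (f : Fin n → ℚ) → a * ∑ f ≡ ∑ (λ i → a * f i)
  *-distribˡ-∑ a f = trans (cong (a *_) (∑≡sum f))
                           (trans (Sum.*-distribˡ-sum a f) (sym (∑≡sum (λ i → a * f i))))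

  ∑-remove : ∀ {n} (f : Fin (suc n) → ℚ) i → ∑ f ≡ f i + ∑ (f ∘ punchIn i)
  ∑-remove f i = trans (∑≡sum f) (trans (Sum.sum-remove f) (cong (f i +_) (sym (∑≡sum (f ∘ punchIn i)))))

  ∑-const : ∀ {n} a → ∑ {n} (λ _ → a) ≡ fromℕ n * a
  ∑-const {zero}  a = sym (ℚₚ.*-zeroˡ a)
  ∑-const {suc n} a = begin
    a + ∑ {n} (λ _ → a)     ≡⟨ cong (a +_) (∑-const {n} a) ⟩
    a + fromℕ n * a         ≡⟨ cong (_+ fromℕ n * a) (ℚₚ.*-identityˡ a) ⟨
    1ℚ * a + fromℕ n * a    ≡⟨ ℚₚ.*-distribʳ-+ a 1ℚ (fromℕ n) ⟨
    (1ℚ + fromℕ n) * a      ≡⟨ cong (_* a) (fromℕ-suc n) ⟨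
    fromℕ (suc n) * a       ∎

  ∑-zero : ∀ {n} → ∑ {n} (λ _ → 0ℚ) ≡ 0ℚ
  ∑-zero {n} = trans (∑-const {n} 0ℚ) (ℚₚ.*-zeroʳ (fromℕ n))

  ∑-cast : ∀ {m n} (eq : m ≡ n) (f : Fin n → ℚ) → ∑ (f ∘ cast eq) ≡ ∑ f
  ∑-cast refl f = ∑-cong (cong f ∘ Finₚ.cast-is-id refl)

  infix 7 _·_

  _·_ : ∀ {n} → (Fin n → ℚ) → (Fin n → ℚ) → ℚ
  u · w = ∑ (λ j → u j * w j)

  ·-comm : ∀ {n} (u w : Fin n → ℚ) → u · w ≡ w · u
  ·-comm u w = ∑-cong (λ j → ℚₚ.*-comm (u j) (w j))

  ·-zeroʳ : ∀ {n} (u : Fin n → ℚ) → u · (λ _ → 0ℚ) ≡ 0ℚ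
  ·-zeroʳ {n} u = trans (∑-cong (ℚₚ.*-zeroʳ ∘ u)) (∑-zero {n})

  ·-scaleʳ : ∀ {n} (u w : Fin n → ℚ) a → u · (λ j → a * w j) ≡ a * (u · w)
  ·-scaleʳ u w a = trans (∑-cong (λ j → swap (u j) a (w j))) (sym (*-distribˡ-∑ a (λ j → u j * w j)))
    where
    swap : ∀ x a y → x * (a * y) ≡ a * (x * y)
    swap = solve-∀ ℚ-ring

  ·-linearˡ : ∀ {n} a (u u′ w : Fin n → ℚ) → (λ j → a * u j + u′ j) · w ≡ a * (u · w) + u′ · w
  ·-linearˡ a u u′ w = begin
    ∑ (λ j → (a * u j + u′ j) * w j)          ≡⟨ ∑-cong (λ j → distrib a (u j) (u′ j) (w j)) ⟩
    ∑ (λ j → a * (u j * w j) + u′ j * w j)    ≡⟨ ∑-distrib-+ (λ j → a * (u j * w j)) (λ j → u′ j * w j) ⟩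
    ∑ (λ j → a * (u j * w j)) + u′ · w        ≡⟨ cong (_+ u′ · w) (*-distribˡ-∑ a (λ j → u j * w j)) ⟨
    a * (u · w) + u′ · w                      ∎
    where
    distrib : ∀ a u u′ w → (a * u + u′) * w ≡ a * (u * w) + u′ * w
    distrib = solve-∀ ℚ-ring

module LinearAlgebra where
  open import Data.Rational using (_+_; _*_; _-_; -_)
  open import Data.Vec.Functional using (_∷_; insertAt)
  import Data.Vec.Functional.Properties as Vectorₚ
  open Arithmetic
  open Sums
  open ≡-Reasoning

  Matrix : ℕ → ℕ → Set
  Matrix m n = Fin m → Fin n → ℚ

  _ᵀ : ∀ {m n} → Matrix m n → Matrix n m
  (M ᵀ) i j = M j i

  _*ᴹ_ : ∀ {m n p} → Matrix m n → Matrix n p → Matrix m p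
  (M *ᴹ R) x y = M x · (R ᵀ) y

  ·-adjoint : ∀ {m n} (u : Fin m → ℚ) (M : Matrix m n) (c : Fin n → ℚ) →
              u · (λ j → c · M j) ≡ c · (λ l → u · (M ᵀ) l)
  ·-adjoint u M c = begin
    ∑ (λ j → u j * ∑ (λ l → c l * M j l))     ≡⟨ ∑-cong (λ j → *-distribˡ-∑ (u j) (λ l → c l * M j l)) ⟩
    ∑ (λ j → ∑ (λ l → u j * (c l * M j l)))   ≡⟨ ∑-cong (λ j → ∑-cong (λ l → swap (u j) (c l) (M j l))) ⟩
    ∑ (λ j → ∑ (λ l → c l * (u j * M j l)))   ≡⟨ ∑-comm (λ j l → c l * (u j * M j l)) ⟩
    ∑ (λ l → ∑ (λ j → c l * (u j * M j l)))   ≡⟨ ∑-cong (λ l → *-distribˡ-∑ (c l) (λ j → u j * M j l)) ⟨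
    ∑ (λ l → c l * ∑ (λ j → u j * M j l))     ∎
    where
    swap : ∀ x a y → x * (a * y) ≡ a * (x * y)
    swap = solve-∀ ℚ-ring

  δ : ∀ {n} → Fin n → Fin n → ℚ
  δ zero    zero    = 1ℚ
  δ zero    (suc j) = 0ℚ
  δ (suc i) zero    = 0ℚ
  δ (suc i) (suc j) = δ i j

  δ-sym : ∀ {n} (i j : Fin n) → δ i j ≡ δ j i
  δ-sym zero    zero    = refl
  δ-sym zero    (suc j) = refl
  δ-sym (suc i) zero    = refl
  δ-sym (suc i) (suc j) = δ-sym i j

  δ-refl : ∀ {n} (i : Fin n) → δ i i ≡ 1ℚ
  δ-refl zero    = refl
  δ-refl (suc i) = δ-refl i

  δ-≢ : ∀ {n} {i j : Fin n} → i ≢ j → δ i j ≡ 0ℚ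
  δ-≢ {i = zero}  {zero}  i≢j = ⊥-elim (i≢j refl)
  δ-≢ {i = zero}  {suc j} i≢j = refl
  δ-≢ {i = suc i} {zero}  i≢j = refl
  δ-≢ {i = suc i} {suc j} i≢j = δ-≢ (i≢j ∘ cong suc)

  ·-δ : ∀ {n} (u : Fin n → ℚ) i → u · δ i ≡ u i
  ·-δ {suc n} u zero    = begin
    u zero * 1ℚ + ∑ (λ j → u (suc j) * 0ℚ)  ≡⟨ cong₂ _+_ (ℚₚ.*-identityʳ (u zero)) (·-zeroʳ (u ∘ suc)) ⟩
    u zero + 0ℚ                             ≡⟨ ℚₚ.+-identityʳ (u zero) ⟩
    u zero                                  ∎
  ·-δ {suc n} u (suc i) = begin
    u zero * 0ℚ + (u ∘ suc) · δ i            ≡⟨ cong₂ _+_ (ℚₚ.*-zeroʳ (u zero)) (·-δ (u ∘ suc) i) ⟩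
    0ℚ + u (suc i)                          ≡⟨ ℚₚ.+-identityˡ (u (suc i)) ⟩
    u (suc i)                               ∎

  δ-· : ∀ {n} i (u : Fin n → ℚ) → δ i · u ≡ u i
  δ-· i u = trans (·-comm (δ i) u) (·-δ u i)

  independent-of-leftInverse : ∀ {m n s} (L : Matrix n m) (M : Matrix m n) → s ≢ 0ℚ →
                               (∀ x y → (L *ᴹ M) x y ≡ s * δ x y) → IndependentColumns M id
  independent-of-leftInverse {s = s} L M s≢0 LM≡sI c Mc≡0 y = ab≡0⇒b≡0 s≢0 (begin
    s * c y                           ≡⟨ cong (s *_) (·-δ c y) ⟨
    s * (c · δ y)                     ≡⟨ ·-scaleʳ c (δ y) s ⟨
    c · (λ l → s * δ y l)             ≡⟨ ∑-cong (λ l → cong (c l *_) (LM≡sI y l)) ⟨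
    c · (λ l → (L *ᴹ M) y l)          ≡⟨ ·-adjoint (L y) M c ⟨
    L y · (λ j → c · M j)             ≡⟨ ∑-cong (λ j → cong (L y j *_) (Mc≡0 j)) ⟩
    L y · (λ _ → 0ℚ)                  ≡⟨ ·-zeroʳ (L y) ⟩
    0ℚ                                ∎)

  rows-independent-of-rightInverse : ∀ {m n s} (M : Matrix m n) (R : Matrix n m) → s ≢ 0ℚ →
                                     (∀ x y → (M *ᴹ R) x y ≡ s * δ x y) → IndependentColumns (M ᵀ) id
  rows-independent-of-rightInverse {s = s} M R s≢0 MR≡sI =
    independent-of-leftInverse (R ᵀ) (M ᵀ) s≢0 λ x y →
      trans (·-comm ((R ᵀ) x) (M y)) (trans (MR≡sI y x) (cong (s *_) (δ-sym y x)))

  independent-cong : ∀ {m n} {M M′ : Matrix m n} → (∀ i l → M i l ≡ M′ i l) →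
                     IndependentColumns M id → IndependentColumns M′ id
  independent-cong M≡M′ indep c M′c≡0 =
    indep c (λ i → trans (∑-cong (λ l → cong (c l *_) (M≡M′ i l))) (M′c≡0 i))

  independent-minor : ∀ {d n} (M : Matrix (suc d) (suc n)) → (∀ l → M zero l ≡ 0ℚ) →
                      IndependentColumns M id → IndependentColumns (λ i l → M (suc i) (suc l)) id
  independent-minor M M₀≡0 indep c Mc≡0 l = indep (0ℚ ∷ c) rows (suc l)
    where
    rows : ∀ i → (0ℚ ∷ c) · M i ≡ 0ℚ
    rows zero    = begin
      0ℚ * M zero zero + c · (M zero ∘ suc)  ≡⟨ cong₂ _+_ (ℚₚ.*-zeroˡ (M zero zero))
                                                           (∑-cong (λ l → cong (c l *_) (M₀≡0 (suc l)))) ⟩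
      0ℚ + c · (λ _ → 0ℚ)                    ≡⟨ ℚₚ.+-identityˡ _ ⟩
      c · (λ _ → 0ℚ)                         ≡⟨ ·-zeroʳ c ⟩
      0ℚ                                     ∎
    rows (suc i) = trans (cong₂ _+_ (ℚₚ.*-zeroˡ (M (suc i) zero)) (Mc≡0 i)) (ℚₚ.+-identityˡ 0ℚ)

  -- One step of Gaussian elimination on row 0: a dependency c of the reduced matrix lifts to the
  -- dependency of M that is pivot · c off column p.
  module Elimination {d n} (M : Matrix (suc d) (suc n)) (p : Fin (suc n)) where

    pivot : ℚ
    pivot = M zero p

    reduced : Matrix d n
    reduced i l = pivot * M (suc i) (punchIn p l) - M zero (punchIn p l) * M (suc i) p

    lift : (Fin n → ℚ) → Fin (suc n) → ℚ
    lift c = insertAt (λ l → pivot * c l) p (- (c · (M zero ∘ punchIn p)))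

    lift-· : ∀ c (r : Fin (suc n) → ℚ) →
             lift c · r ≡ c · (λ l → pivot * r (punchIn p l) - M zero (punchIn p l) * r p)
    lift-· c r = begin
      lift c · r
        ≡⟨ ∑-remove (λ m → lift c m * r m) p ⟩
      lift c p * r p + ∑ (λ l → lift c (punchIn p l) * r (punchIn p l))
        ≡⟨ cong₂ _+_ (cong (_* r p) (Vectorₚ.insertAt-lookup _ p _))
                     (∑-cong (λ l → cong (_* r (punchIn p l)) (Vectorₚ.insertAt-punchIn _ p _ l))) ⟩
      - (c · m) * r p + T
        ≡⟨ reorder (c · m) (r p) T ⟩
      T + (- r p) * (c · m)
        ≡⟨ cong (T +_) (*-distribˡ-∑ (- r p) (λ l → c l * m l)) ⟩
      T + ∑ (λ l → (- r p) * (c l * m l))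
        ≡⟨ ∑-distrib-+ (λ l → pivot * c l * r (punchIn p l)) (λ l → (- r p) * (c l * m l)) ⟨
      ∑ (λ l → pivot * c l * r (punchIn p l) + (- r p) * (c l * m l))
        ≡⟨ ∑-cong (λ l → collect pivot (c l) (r (punchIn p l)) (m l) (r p)) ⟩
      c · (λ l → pivot * r (punchIn p l) - m l * r p)
        ∎
      where
      m : Fin n → ℚ
      m = M zero ∘ punchIn p
      T : ℚ
      T = ∑ (λ l → pivot * c l * r (punchIn p l))
      reorder : ∀ s x t → - s * x + t ≡ t + (- x) * s
      reorder = solve-∀ ℚ-ring
      collect : ∀ a c x m y → a * c * x + (- y) * (c * m) ≡ c * (a * x - m * y)
      collect = solve-∀ ℚ-ring

    independent-reduced : pivot ≢ 0ℚ → IndependentColumns M id → IndependentColumns reduced id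
    independent-reduced pivot≢0 indep c reduced-c≡0 l =
      ab≡0⇒b≡0 pivot≢0 (trans (sym (Vectorₚ.insertAt-punchIn _ p _ l)) (indep (lift c) rows (punchIn p l)))
      where
      rows : ∀ i → lift c · M i ≡ 0ℚ
      rows zero    = begin
        lift c · M zero                      ≡⟨ lift-· c (M zero) ⟩
        c · (λ l → pivot * m l - m l * pivot) ≡⟨ ∑-cong (λ l → cong (c l *_) (cancels (m l))) ⟩
        c · (λ _ → 0ℚ)                       ≡⟨ ·-zeroʳ c ⟩
        0ℚ                                   ∎
        where
        m : Fin n → ℚ
        m = M zero ∘ punchIn p
        cancels : ∀ x → pivot * x - x * pivot ≡ 0ℚ
        cancels x = trans (cong (λ y → pivot * x - y) (ℚₚ.*-comm x pivot)) (ℚₚ.+-inverseʳ (pivot * x))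
      rows (suc i) = trans (lift-· c (M (suc i))) (reduced-c≡0 i)

  wide⇒¬independent : ∀ {d} (M : Matrix d (suc d)) → ¬ IndependentColumns M id
  wide⇒¬independent {zero}  M indep = ℚₚ.1≢0 (indep (λ _ → 1ℚ) (λ ()) zero)
  wide⇒¬independent {suc d} M indep with Finₚ.all? (λ l → M zero l ≟ 0ℚ)
  ... | yes M₀≡0 = wide⇒¬independent (λ i l → M (suc i) (suc l)) (independent-minor M M₀≡0 indep)
  ... | no  M₀≢0 with Finₚ.¬∀⟶∃¬ _ _ (λ l → M zero l ≟ 0ℚ) M₀≢0
  ...   | p , Mp≢0 = wide⇒¬independent (Elimination.reduced M p) (Elimination.independent-reduced M p Mp≢0 indep)

  -- A nonzero c with M c = 0 would extend the n columns of R, which M maps to s times the unit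
  -- vectors, to n + 1 independent vectors in ℚⁿ.
  independent-of-rightInverse : ∀ {n s} (M R : Matrix n n) → s ≢ 0ℚ →
                                (∀ x y → (M *ᴹ R) x y ≡ s * δ x y) → IndependentColumns M id
  independent-of-rightInverse {n} {s} M R s≢0 MR≡sI c Mc≡0 l with c l ≟ 0ℚ
  ... | yes cₗ≡0 = cₗ≡0
  ... | no  cₗ≢0 = ⊥-elim (wide⇒¬independent W independent-W)
    where
    W : Matrix n (suc n)
    W j = c j ∷ R j

    independent-W : IndependentColumns W id
    independent-W a Wa≡0 = a≡0
      where
      tail≡0 : ∀ x → a (suc x) ≡ 0ℚ
      tail≡0 x = ab≡0⇒b≡0 s≢0 (begin
        s * a (suc x)                                           ≡⟨ cong (s *_) (·-δ (a ∘ suc) x) ⟨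
        s * ((a ∘ suc) · δ x)                                   ≡⟨ ·-scaleʳ (a ∘ suc) (δ x) s ⟨
        (a ∘ suc) · (λ y → s * δ x y)                           ≡⟨ ∑-cong (λ y → cong (a (suc y) *_) (MR≡sI x y)) ⟨
        (a ∘ suc) · (λ y → (M *ᴹ R) x y)                        ≡⟨ ℚₚ.+-identityˡ _ ⟨
        0ℚ + (a ∘ suc) · (λ y → (M *ᴹ R) x y)                   ≡⟨ cong (_+ (a ∘ suc) · (λ y → (M *ᴹ R) x y)) a₀Mc≡0 ⟨
        a zero * (M x · c) + (a ∘ suc) · (λ y → (M *ᴹ R) x y)   ≡⟨ ·-adjoint (M x) W a ⟨
        M x · (λ j → a · W j)                                   ≡⟨ ∑-cong (λ j → cong (M x j *_) (Wa≡0 j)) ⟩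
        M x · (λ _ → 0ℚ)                                        ≡⟨ ·-zeroʳ (M x) ⟩
        0ℚ                                                      ∎)
        where
        a₀Mc≡0 : a zero * (M x · c) ≡ 0ℚ
        a₀Mc≡0 = trans (cong (a zero *_) (trans (·-comm (M x) c) (Mc≡0 x))) (ℚₚ.*-zeroʳ (a zero))

      head≡0 : a zero ≡ 0ℚ
      head≡0 = ab≡0⇒b≡0 cₗ≢0 (begin
        c l * a zero                    ≡⟨ ℚₚ.*-comm (c l) (a zero) ⟩
        a zero * c l                    ≡⟨ ℚₚ.+-identityʳ _ ⟨
        a zero * c l + 0ℚ               ≡⟨ cong (a zero * c l +_) (R-part≡0) ⟨
        a zero * c l + (a ∘ suc) · R l  ≡⟨ Wa≡0 l ⟩
        0ℚ                              ∎)
        where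
        R-part≡0 : (a ∘ suc) · R l ≡ 0ℚ
        R-part≡0 = trans (∑-cong (λ y → trans (cong (_* R l y) (tail≡0 y)) (ℚₚ.*-zeroˡ (R l y)))) (∑-zero {n})

      a≡0 : ∀ m → a m ≡ 0ℚ
      a≡0 zero    = head≡0
      a≡0 (suc x) = tail≡0 x

module Polynomials where
  open import Data.Rational using (_+_; _*_)
  open import Data.List using ([]; _∷_)
  open import Data.List.Relation.Unary.All using ([]; _∷_)
  open Sums
  open ≡-Reasoning

  ∑ℕ-zero : ∀ {n} → ∑ℕ {n} (λ _ → 0) ≡ 0
  ∑ℕ-zero {zero}  = refl
  ∑ℕ-zero {suc n} = ∑ℕ-zero {n}

  ∏-one : ∀ {n} → ∏ {n} (λ _ → 1ℚ) ≡ 1ℚ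
  ∏-one {zero}  = refl
  ∏-one {suc n} = trans (ℚₚ.*-identityˡ _) (∏-one {n})

  monomial-constant : ∀ {r} (e : Exponent r) → ∑ℕ e ≡ 0 → ∀ x → monomial e x ≡ 1ℚ
  monomial-constant {zero}  e _     x = refl
  monomial-constant {suc r} e |e|≡0 x with e zero
  ... | zero = trans (ℚₚ.*-identityˡ _) (monomial-constant (e ∘ suc) |e|≡0 (x ∘ suc))

  monomial-linear : ∀ {r} (e : Exponent r) → ∑ℕ e ≡ 1 → Σ (Fin r) λ i → ∀ x → monomial e x ≡ x i
  monomial-linear {suc r} e |e|≡1 with e zero
  ... | 0 with monomial-linear (e ∘ suc) |e|≡1
  ...   | i , eᵢ = suc i , λ x → trans (ℚₚ.*-identityˡ _) (eᵢ (x ∘ suc))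
  monomial-linear {suc r} e |e|≡1 | 1 = zero , λ x → begin
    x zero * 1ℚ * monomial (e ∘ suc) (x ∘ suc)
      ≡⟨ cong (x zero * 1ℚ *_) (monomial-constant (e ∘ suc) (ℕₚ.suc-injective |e|≡1) (x ∘ suc)) ⟩
    x zero * 1ℚ * 1ℚ
      ≡⟨ ℚₚ.*-identityʳ _ ⟩
    x zero * 1ℚ
      ≡⟨ ℚₚ.*-identityʳ _ ⟩
    x zero
      ∎

  monomial-quadratic : ∀ {r} (e : Exponent r) → ∑ℕ e ≡ 2 →
                       Σ (Fin r) λ i → Σ (Fin r) λ j → ∀ x → monomial e x ≡ x i * x j
  monomial-quadratic {suc r} e |e|≡2 with e zero
  ... | 0 with monomial-quadratic (e ∘ suc) |e|≡2
  ...   | i , j , eᵢⱼ = suc i , suc j , λ x → trans (ℚₚ.*-identityˡ _) (eᵢⱼ (x ∘ suc))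
  monomial-quadratic {suc r} e |e|≡2 | 1 with monomial-linear (e ∘ suc) (ℕₚ.suc-injective |e|≡2)
  ...   | j , eⱼ = zero , suc j , λ x → cong₂ _*_ (ℚₚ.*-identityʳ (x zero)) (eⱼ (x ∘ suc))
  monomial-quadratic {suc r} e |e|≡2 | 2 = zero , zero , λ x → begin
    x zero * (x zero * 1ℚ) * monomial (e ∘ suc) (x ∘ suc)
      ≡⟨ cong₂ (λ a b → x zero * a * b) (ℚₚ.*-identityʳ (x zero))
               (monomial-constant (e ∘ suc) (ℕₚ.suc-injective (ℕₚ.suc-injective |e|≡2)) (x ∘ suc)) ⟩
    x zero * x zero * 1ℚ
      ≡⟨ ℚₚ.*-identityʳ _ ⟩
    x zero * x zero
      ∎

  unitExponent : ∀ {r} → Fin r → Exponent r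
  unitExponent zero    zero    = 1
  unitExponent zero    (suc j) = 0
  unitExponent (suc i) zero    = 0
  unitExponent (suc i) (suc j) = unitExponent i j

  ∑ℕ-unitExponent : ∀ {r} (i : Fin r) → ∑ℕ (unitExponent i) ≡ 1
  ∑ℕ-unitExponent {suc r} zero    = cong suc (∑ℕ-zero {r})
  ∑ℕ-unitExponent         (suc i) = ∑ℕ-unitExponent i

  monomial-unitExponent : ∀ {r} (i : Fin r) x → monomial (unitExponent i) x ≡ x i
  monomial-unitExponent {suc r} zero    x =
    trans (cong₂ _*_ (ℚₚ.*-identityʳ (x zero)) (∏-one {r})) (ℚₚ.*-identityʳ (x zero))
  monomial-unitExponent         (suc i) x = trans (ℚₚ.*-identityˡ _) (monomial-unitExponent i (x ∘ suc))

  coordinate : ∀ {r} → Fin r → Poly r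
  coordinate i = (1ℚ , unitExponent i) ∷ []

  eval-coordinate : ∀ {r} (i : Fin r) x → eval (coordinate i) x ≡ x i
  eval-coordinate i x = trans (ℚₚ.+-identityʳ _) (trans (ℚₚ.*-identityˡ _) (monomial-unitExponent i x))

  ·-coordinates : ∀ {r} (c x : Point r) → c · (λ i → eval (coordinate i) x) ≡ c · x
  ·-coordinates c x = ∑-cong (λ i → cong (c i *_) (eval-coordinate i x))

  InSpanOn : ∀ {r d} → (Point r → Set) → (Fin d → Poly r) → (Point r → ℚ) → Set
  InSpanOn {d = d} Ω ts f = Σ (Fin d → ℚ) λ c → ∀ x → Ω x → f x ≡ c · (λ i → eval (ts i) x)

  span-of-monomials : ∀ {r d t} {Ω : Point r → Set} (ts : Fin d → Poly r) →
                      (∀ e → ∑ℕ e ≤ t → InSpanOn Ω ts (monomial e)) →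
                      ∀ p → DegreeAtMost t p → InSpanOn Ω ts (eval p)
  span-of-monomials {d = d} ts monomials [] [] =
    (λ _ → 0ℚ) , λ x _ → sym (trans (∑-cong (λ i → ℚₚ.*-zeroˡ (eval (ts i) x))) (∑-zero {d}))
  span-of-monomials ts monomials ((a , e) ∷ p) (|e|≤t ∷ deg-p)
    with monomials e |e|≤t | span-of-monomials ts monomials p deg-p
  ... | c , e≡c | c′ , p≡c′ = (λ i → a * c i + c′ i) , λ x x∈Ω → begin
    a * monomial e x + eval p x          ≡⟨ cong₂ (λ u v → a * u + v) (e≡c x x∈Ω) (p≡c′ x x∈Ω) ⟩
    a * (c · tsₓ x) + c′ · tsₓ x         ≡⟨ ·-linearˡ a c c′ (tsₓ x) ⟨
    (λ i → a * c i + c′ i) · tsₓ x       ∎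
    where
    tsₓ : Point _ → Point _
    tsₓ x i = eval (ts i) x

module TightPTE where
  open import Data.Rational using (_*_; 1/_; NonZero; ≢-nonZero)
  open import Data.List.Relation.Unary.All using ([]; _∷_)
  open Arithmetic
  open Sums
  open LinearAlgebra
  open Polynomials
  open ≡-Reasoning

  binary-idempotent : ∀ {a} → a ≡ 0ℚ ⊎ a ≡ 1ℚ → a * a ≡ a
  binary-idempotent (inj₁ refl) = refl
  binary-idempotent (inj₂ refl) = refl

  binary-square : ∀ {a} → a ≡ 0ℚ ⊎ a ≡ 1ℚ → a ^ 2 ≡ a
  binary-square {a} a∈01 = trans (cong (a *_) (ℚₚ.*-identityʳ a)) (binary-idempotent a∈01)

  ∑-on-sphere : ∀ {r κ x} → BinarySphere r κ x → ∑ x ≡ fromℕ κ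
  ∑-on-sphere (binary , ∑x²≡κ) = trans (∑-cong (λ i → sym (binary-square (binary i)))) ∑x²≡κ

  coordinates-basis : ∀ {r κ} (N : Matrix r r) → fromℕ κ ≢ 0ℚ → (∀ l → BinarySphere r κ ((N ᵀ) l)) →
                      IndependentColumns (N ᵀ) id → IsBasisP r 1 (BinarySphere r κ) r coordinate
  coordinates-basis {r} {κ} N κ≢0 on-sphere rows-independent =
      (λ i → ℕₚ.≤-reflexive (∑ℕ-unitExponent i) ∷ [])
    , independent
    , span-of-monomials coordinate monomials-in-span
    where
    independent : ∀ c → (∀ x → BinarySphere r κ x → c · (λ i → eval (coordinate i) x) ≡ 0ℚ) →
                  ∀ i → c i ≡ 0ℚ
    independent c vanishes =
      rows-independent c (λ l → trans (sym (·-coordinates c ((N ᵀ) l))) (vanishes ((N ᵀ) l) (on-sphere l)))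

    instance
      κ-nonZero : NonZero (fromℕ κ)
      κ-nonZero = ≢-nonZero κ≢0

    κ⁻¹ : ℚ
    κ⁻¹ = 1/ fromℕ κ

    monomials-in-span : ∀ e → ∑ℕ e ≤ 1 → InSpanOn (BinarySphere r κ) coordinate (monomial e)
    monomials-in-span e |e|≤1 with ∑ℕ e in |e|≡
    ... | 0 = (λ _ → κ⁻¹) , λ x x∈S → begin
      monomial e x                                  ≡⟨ monomial-constant e |e|≡ x ⟩
      1ℚ                                            ≡⟨ ℚₚ.*-inverseˡ (fromℕ κ) ⟨
      κ⁻¹ * fromℕ κ                                 ≡⟨ cong (κ⁻¹ *_) (∑-on-sphere {κ = κ} x∈S) ⟨
      κ⁻¹ * ∑ x                                     ≡⟨ *-distribˡ-∑ κ⁻¹ x ⟩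
      (λ _ → κ⁻¹) · x                               ≡⟨ ·-coordinates (λ _ → κ⁻¹) x ⟨
      (λ _ → κ⁻¹) · (λ i → eval (coordinate i) x)   ∎
    ... | 1 with monomial-linear e |e|≡
    ...   | i , eᵢ = δ i , λ x _ → begin
      monomial e x                                  ≡⟨ eᵢ x ⟩
      x i                                           ≡⟨ δ-· i x ⟨
      δ i · x                                       ≡⟨ ·-coordinates (δ i) x ⟨
      δ i · (λ j → eval (coordinate j) x)           ∎
    monomials-in-span e (s≤s ()) | suc (suc _)

  isPTE-of-moments : ∀ {r n} (A B : Fin n → Point r) → (∀ i j → ¬ (∀ l → A i l ≡ B j l)) →
                     (∀ i → ∑ ((A ᵀ) i) ≡ ∑ ((B ᵀ) i)) →
                     (∀ i j → (A ᵀ) i · (A ᵀ) j ≡ (B ᵀ) i · (B ᵀ) j) → IsPTE r 2 n A B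
  isPTE-of-moments {r} A B A≢B first second = A≢B , moments
    where
    via : ∀ e {f : Point r → ℚ} → (∀ x → monomial e x ≡ f x) → ∑ (λ l → f (A l)) ≡ ∑ (λ l → f (B l)) →
          ∑ (λ l → monomial e (A l)) ≡ ∑ (λ l → monomial e (B l))
    via _ e≡f f-moments = trans (∑-cong (e≡f ∘ A)) (trans f-moments (sym (∑-cong (e≡f ∘ B))))

    moments : ∀ e → 1 ≤ ∑ℕ e → ∑ℕ e ≤ 2 → ∑ (λ l → monomial e (A l)) ≡ ∑ (λ l → monomial e (B l))
    moments e 1≤|e| |e|≤2 with ∑ℕ e in |e|≡
    moments e () _ | 0
    moments e _ _ | 1 with monomial-linear e |e|≡
    ... | i , eᵢ = via e eᵢ (first i)
    moments e _ _ | 2 with monomial-quadratic e |e|≡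
    ... | i , j , eᵢⱼ = via e eᵢⱼ (second i j)
    moments e _ (s≤s (s≤s ())) | suc (suc (suc _))

  hasRank-NAB : ∀ {r n} (ts : Fin n → Poly r) (A B : Fin n → Point r) →
                IndependentColumns (λ i l → eval (ts i) (A l)) id → HasRank (NAB ts A B) n
  hasRank-NAB {n = n} ts A B independent =
    (_↑ˡ n , independent-A) , λ σ → wide⇒¬independent (λ i l → NAB ts A B i (σ l))
    where
    independent-A : IndependentColumns (NAB ts A B) (_↑ˡ n)
    independent-A c vanishes = independent c λ i →
      trans (∑-cong (λ l → cong (λ z → c l * eval (ts i) ([ A , B ] z)) (sym (Finₚ.splitAt-↑ˡ n l n)))) (vanishes i)

module Designs where
  open import Data.Rational using (_+_; _*_; _-_; -_)
  open import Data.Bool using (Bool; true; false)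
  open import Data.Fin.Subset using (Subset; ∣_∣)
  open import Data.List as List using (List; []; _∷_; length)
  import Data.List.Relation.Unary.All as All
  open import Data.List.Membership.Propositional using (_∈_)
  open import Data.List.Membership.Propositional.Properties using (∈-lookup)
  open import Data.Product using (proj₁; proj₂)
  import Data.Vec as Vec
  import Data.Vec.Properties as Vecₚ
  open Arithmetic
  open Sums
  open LinearAlgebra
  open Polynomials
  open TightPTE
  open ≡-Reasoning

  indicator : Bool → ℚ
  indicator true  = 1ℚ
  indicator false = 0ℚ

  indicator-binary : ∀ b → indicator b ≡ 0ℚ ⊎ indicator b ≡ 1ℚ
  indicator-binary true  = inj₂ refl
  indicator-binary false = inj₁ refl

  indicator-injective : ∀ {a b} → indicator a ≡ indicator b → a ≡ b
  indicator-injective {true}  {true}  _ = refl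
  indicator-injective {true}  {false} 1≡0 = ⊥-elim (ℚₚ.1≢0 1≡0)
  indicator-injective {false} {true}  0≡1 = ⊥-elim (ℚₚ.1≢0 (sym 0≡1))
  indicator-injective {false} {false} _ = refl

  characteristic : ∀ {n} → Subset n → Point n
  characteristic B x = indicator (Vec.lookup B x)

  characteristic-injective : ∀ {n} {B C : Subset n} → (∀ x → characteristic B x ≡ characteristic C x) → B ≡ C
  characteristic-injective {B = B} {C} B≗C = begin
    B                         ≡⟨ Vecₚ.tabulate∘lookup B ⟨
    Vec.tabulate (Vec.lookup B) ≡⟨ Vecₚ.tabulate-cong (indicator-injective ∘ B≗C) ⟩
    Vec.tabulate (Vec.lookup C) ≡⟨ Vecₚ.tabulate∘lookup C ⟩
    C                         ∎

  ∑-characteristic : ∀ {n} (B : Subset n) → ∑ (characteristic B) ≡ fromℕ ∣ B ∣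
  ∑-characteristic Vec.[]          = refl
  ∑-characteristic (true  Vec.∷ B) = trans (cong (1ℚ +_) (∑-characteristic B)) (sym (fromℕ-suc ∣ B ∣))
  ∑-characteristic (false Vec.∷ B) = trans (ℚₚ.+-identityˡ _) (∑-characteristic B)

  incidence : ∀ {v} (ℬ : List (Subset v)) → Matrix v (length ℬ)
  incidence ℬ x j = characteristic (List.lookup ℬ j) x

  incidence-· : ∀ {v} (ℬ : List (Subset v)) x y → incidence ℬ x · incidence ℬ y ≡ fromℕ (countPair x y ℬ)
  incidence-· []      x y = refl
  incidence-· (B ∷ ℬ) x y with Vec.lookup B x | Vec.lookup B y
  ... | true  | true  =
    trans (cong₂ _+_ (ℚₚ.*-identityˡ 1ℚ) (incidence-· ℬ x y)) (sym (fromℕ-suc (countPair x y ℬ)))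
  ... | true  | false = trans (cong₂ _+_ (ℚₚ.*-zeroʳ 1ℚ) (incidence-· ℬ x y)) (ℚₚ.+-identityˡ _)
  ... | false | b     = trans (cong₂ _+_ (ℚₚ.*-zeroˡ (indicator b)) (incidence-· ℬ x y)) (ℚₚ.+-identityˡ _)

  record IsSymmetricIncidence (v κ λ′ : ℕ) (N : Matrix v v) : Set where
    field
      binary      : ∀ x l → N x l ≡ 0ℚ ⊎ N x l ≡ 1ℚ
      blockSize   : ∀ l → ∑ ((N ᵀ) l) ≡ fromℕ κ
      replication : ∀ x → ∑ (N x) ≡ fromℕ κ
      pairCount   : ∀ {x y} → x ≢ y → N x · N y ≡ fromℕ λ′

    gramEntry : ℚ → ℚ
    gramEntry d = fromℕ λ′ + (fromℕ κ - fromℕ λ′) * d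

    gram : ∀ x y → N x · N y ≡ gramEntry (δ x y)
    gram x y with x Finₚ.≟ y
    ... | yes refl = begin
      N x · N x      ≡⟨ ∑-cong (λ l → binary-idempotent (binary x l)) ⟩
      ∑ (N x)        ≡⟨ replication x ⟩
      fromℕ κ        ≡⟨ diagonal (fromℕ κ) (fromℕ λ′) ⟩
      gramEntry 1ℚ       ≡⟨ cong gramEntry (δ-refl x) ⟨
      gramEntry (δ x x)  ∎
      where
      diagonal : ∀ k l → k ≡ l + (k - l) * 1ℚ
      diagonal = solve-∀ ℚ-ring
    ... | no x≢y = begin
      N x · N y      ≡⟨ pairCount x≢y ⟩
      fromℕ λ′       ≡⟨ off-diagonal (fromℕ κ) (fromℕ λ′) ⟩
      gramEntry 0ℚ       ≡⟨ cong gramEntry (δ-≢ x≢y) ⟨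
      gramEntry (δ x y)  ∎
      where
      off-diagonal : ∀ k l → l ≡ l + (k - l) * 0ℚ
      off-diagonal = solve-∀ ℚ-ring

    scaledInverse : Matrix v v
    scaledInverse j y = fromℕ κ * N y j - fromℕ λ′

    scaledInverseʳ : ∀ x y → (N *ᴹ scaledInverse) x y ≡ fromℕ κ * (fromℕ κ - fromℕ λ′) * δ x y
    scaledInverseʳ x y = begin
      N x · (λ j → k * N y j - l)
        ≡⟨ ∑-cong (λ j → distribute k l (N x j) (N y j)) ⟩
      ∑ (λ j → k * (N x j * N y j) + (- l) * N x j)
        ≡⟨ ∑-distrib-+ (λ j → k * (N x j * N y j)) (λ j → (- l) * N x j) ⟩
      ∑ (λ j → k * (N x j * N y j)) + ∑ (λ j → (- l) * N x j)
        ≡⟨ cong₂ _+_ (*-distribˡ-∑ k (λ j → N x j * N y j)) (*-distribˡ-∑ (- l) (N x)) ⟨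
      k * (N x · N y) + (- l) * ∑ (N x)
        ≡⟨ cong₂ (λ g r → k * g + (- l) * r) (gram x y) (replication x) ⟩
      k * (l + (k - l) * δ x y) + (- l) * k
        ≡⟨ collect k l (δ x y) ⟩
      k * (k - l) * δ x y
        ∎
      where
      k l : ℚ
      k = fromℕ κ
      l = fromℕ λ′
      distribute : ∀ k l a b → a * (k * b - l) ≡ k * (a * b) + (- l) * a
      distribute = solve-∀ ℚ-ring
      collect : ∀ k l d → k * (l + (k - l) * d) + (- l) * k ≡ k * (k - l) * d
      collect = solve-∀ ℚ-ring

    columns-on-sphere : ∀ l → BinarySphere v κ ((N ᵀ) l)
    columns-on-sphere l = (λ x → binary x l) , trans (∑-cong (λ x → binary-square (binary x l))) (blockSize l)

  module TwoDesign {w κ λ′} {ℬ : List (Subset (suc w))} (design : Is2Design (suc w) κ λ′ ℬ) where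

    N : Matrix (suc w) (length ℬ)
    N = incidence ℬ

    blockSize : ∀ j → ∑ ((N ᵀ) j) ≡ fromℕ κ
    blockSize j = trans (∑-characteristic (List.lookup ℬ j)) (cong fromℕ (All.lookup (proj₁ design) (∈-lookup j)))

    pairCount : ∀ {x y} → x ≢ y → N x · N y ≡ fromℕ λ′
    pairCount {x} {y} x≢y = trans (incidence-· ℬ x y) (cong fromℕ (proj₂ design x y x≢y))

    -- Double counting of ∑_y N x · N y, the pairs (y, block) with x and y in the block.
    replication-identity : ∀ x → ∑ (N x) * fromℕ κ ≡ ∑ (N x) + fromℕ w * fromℕ λ′
    replication-identity x = begin
      ∑ (N x) * fromℕ κ                               ≡⟨ ℚₚ.*-comm (∑ (N x)) (fromℕ κ) ⟩
      fromℕ κ * ∑ (N x)                               ≡⟨ *-distribˡ-∑ (fromℕ κ) (N x) ⟩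
      ∑ (λ j → fromℕ κ * N x j)                       ≡⟨ ∑-cong (λ j → ℚₚ.*-comm (fromℕ κ) (N x j)) ⟩
      N x · (λ _ → fromℕ κ)                           ≡⟨ ∑-cong (λ j → cong (N x j *_) (blockSize j)) ⟨
      N x · (λ j → ∑ ((N ᵀ) j))                       ≡⟨ ∑-cong (λ j → *-distribˡ-∑ (N x j) ((N ᵀ) j)) ⟩
      ∑ (λ j → ∑ (λ y → N x j * N y j))               ≡⟨ ∑-comm (λ y j → N x j * N y j) ⟨
      ∑ (λ y → N x · N y)                             ≡⟨ ∑-remove (λ y → N x · N y) x ⟩
      N x · N x + ∑ (λ l → N x · N (punchIn x l))     ≡⟨ cong₂ _+_ diagonal (∑-cong off-diagonal) ⟩
      ∑ (N x) + ∑ {w} (λ _ → fromℕ λ′)                ≡⟨ cong (∑ (N x) +_) (∑-const {w} (fromℕ λ′)) ⟩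
      ∑ (N x) + fromℕ w * fromℕ λ′                    ∎
      where
      diagonal : N x · N x ≡ ∑ (N x)
      diagonal = ∑-cong (λ j → binary-idempotent (indicator-binary (Vec.lookup (List.lookup ℬ j) x)))
      off-diagonal : ∀ l → N x · N (punchIn x l) ≡ fromℕ λ′
      off-diagonal l = pairCount (Finₚ.punchInᵢ≢i x l ∘ sym)

    -- κκ ≡ κ + wλ′ is κ(κ − 1) = λ(v − 1) for v = 1 + w, the parameter condition of a symmetric design.
    module Symmetric (1<κ : 1 ℕ.< κ) (κκ≡κ+wλ : κ ℕ.* κ ≡ κ ℕ.+ w ℕ.* λ′) where

      replication : ∀ x → ∑ (N x) ≡ fromℕ κ
      replication x = *-cancelʳ-≡ (fromℕ-≢ (ℕₚ.>⇒≢ 1<κ)) (begin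
        r * (k - 1ℚ)              ≡⟨ expand r k ⟩
        r * k - r                 ≡⟨ cong (_- r) (replication-identity x) ⟩
        r + W - r                 ≡⟨ cancel r W ⟩
        W                         ≡⟨ cancel k W ⟨
        k + W - k                 ≡⟨ cong (_- k) κκ≡κ+W ⟨
        k * k - k                 ≡⟨ expand k k ⟨
        k * (k - 1ℚ)              ∎)
        where
        r k W : ℚ
        r = ∑ (N x)
        k = fromℕ κ
        W = fromℕ w * fromℕ λ′
        κκ≡κ+W : k * k ≡ k + W
        κκ≡κ+W = begin
          k * k                     ≡⟨ fromℕ-* κ κ ⟨
          fromℕ (κ ℕ.* κ)           ≡⟨ cong fromℕ κκ≡κ+wλ ⟩
          fromℕ (κ ℕ.+ w ℕ.* λ′)    ≡⟨ fromℕ-+ κ (w ℕ.* λ′) ⟩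
          k + fromℕ (w ℕ.* λ′)      ≡⟨ cong (k +_) (fromℕ-* w λ′) ⟩
          k + W                     ∎
        expand : ∀ a b → a * (b - 1ℚ) ≡ a * b - a
        expand = solve-∀ ℚ-ring
        cancel : ∀ a b → a + b - a ≡ b
        cancel = solve-∀ ℚ-ring

      blocks≡points : length ℬ ≡ suc w
      blocks≡points = fromℕ-injective (*-cancelʳ-≡ κ≢0 (begin
        fromℕ (length ℬ) * fromℕ κ       ≡⟨ ∑-const {length ℬ} (fromℕ κ) ⟨
        ∑ {length ℬ} (λ _ → fromℕ κ)     ≡⟨ ∑-cong blockSize ⟨
        ∑ (λ j → ∑ ((N ᵀ) j))            ≡⟨ ∑-comm (N ᵀ) ⟩
        ∑ (λ x → ∑ (N x))                ≡⟨ ∑-cong replication ⟩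
        ∑ {suc w} (λ _ → fromℕ κ)        ≡⟨ ∑-const {suc w} (fromℕ κ) ⟩
        fromℕ (suc w) * fromℕ κ          ∎))
        where
        κ≢0 : fromℕ κ ≢ 0ℚ
        κ≢0 = fromℕ-≢0 (ℕₚ.<-trans (s≤s ℕ.z≤n) 1<κ)

      block : Fin (suc w) → Subset (suc w)
      block l = List.lookup ℬ (cast (sym blocks≡points) l)

      block∈ℬ : ∀ l → block l ∈ ℬ
      block∈ℬ l = ∈-lookup (cast (sym blocks≡points) l)

      square : Matrix (suc w) (suc w)
      square x l = characteristic (block l) x

      isSymmetricIncidence : IsSymmetricIncidence (suc w) κ λ′ square
      isSymmetricIncidence = record
        { binary      = λ x l → indicator-binary (Vec.lookup (block l) x)
        ; blockSize   = blockSize ∘ cast (sym blocks≡points)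
        ; replication = λ x → trans (∑-cast (sym blocks≡points) (N x)) (replication x)
        ; pairCount   = λ {x} {y} x≢y → trans (∑-cast (sym blocks≡points) (λ j → N x j * N y j)) (pairCount x≢y)
        }

  tightPTE-of-symmetricIncidences : ∀ {v κ λ′} {N₁ N₂ : Matrix v v} →
    IsSymmetricIncidence v κ λ′ N₁ → IsSymmetricIncidence v κ λ′ N₂ → λ′ ℕ.< κ →
    (∀ i j → ¬ (∀ x → N₁ x i ≡ N₂ x j)) → IsTightPTE v 1 (BinarySphere v κ) v (N₁ ᵀ) (N₂ ᵀ)
  tightPTE-of-symmetricIncidences {v} {κ} {λ′} {N₁} {N₂} D₁ D₂ λ′<κ columns-differ =
      isPTE-of-moments (N₁ ᵀ) (N₂ ᵀ) columns-differ
        (λ i → trans (D₁.replication i) (sym (D₂.replication i)))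
        (λ i j → trans (D₁.gram i j) (sym (D₂.gram i j)))
    , D₁.columns-on-sphere , D₂.columns-on-sphere
    , v , coordinate
    , coordinates-basis {κ = κ} N₁ κ≢0 D₁.columns-on-sphere rows-independent
    , refl
    , hasRank-NAB coordinate (N₁ ᵀ) (N₂ ᵀ)
        (independent-cong (λ i l → sym (eval-coordinate i ((N₁ ᵀ) l))) columns-independent)
    where
    module D₁ = IsSymmetricIncidence D₁
    module D₂ = IsSymmetricIncidence D₂

    κ≢0 : fromℕ κ ≢ 0ℚ
    κ≢0 = fromℕ-≢0 (ℕₚ.≤-<-trans ℕ.z≤n λ′<κ)

    s≢0 : fromℕ κ * (fromℕ κ - fromℕ λ′) ≢ 0ℚ
    s≢0 = x#0y#0→xy#0 κ≢0 (fromℕ-≢ (ℕₚ.>⇒≢ λ′<κ))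

    rows-independent : IndependentColumns (N₁ ᵀ) id
    rows-independent = rows-independent-of-rightInverse N₁ D₁.scaledInverse s≢0 D₁.scaledInverseʳ

    columns-independent : IndependentColumns N₁ id
    columns-independent = independent-of-rightInverse N₁ D₁.scaledInverse s≢0 D₁.scaledInverseʳ

open import Data.Nat using (ℕ; _≤_; _*_; _∸_)
open import Data.Fin using (Fin)
open import Data.Fin.Subset using (Subset)
open import Data.List using (List)
open import Data.Product using (Σ; _×_)
open import Data.Nat using (_+_; _<_)
import Data.Nat.Tactic.RingSolver as ℕ-Solver
open import Data.List.Membership.Propositional using (_∈_)
open LinearAlgebra using (_ᵀ)
open Designs using (module TwoDesign; characteristic-injective; tightPTE-of-symmetricIncidences)

hadamard-κκ≡κ+wλ : ∀ m → let k = 2 + m in (2 * k ∸ 1) * (2 * k ∸ 1) ≡ (2 * k ∸ 1) + (4 * k ∸ 2) * (k ∸ 1)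
hadamard-κκ≡κ+wλ m = unfolded m
  where
  -- For k = 2 + m every truncated subtraction above reduces, and this is the result up to conversion.
  unfolded : ∀ m → (1 + m + 1 * (2 + m)) * (1 + m + 1 * (2 + m)) ≡ (1 + m + 1 * (2 + m)) + (m + 3 * (2 + m)) * (1 + m)
  unfolded = ℕ-Solver.solve-∀

hadamard-λ<κ : ∀ m → let k = 2 + m in k ∸ 1 < 2 * k ∸ 1
hadamard-λ<κ m = s≤s (ℕₚ.m<m+n m (s≤s ℕ.z≤n))

proposition3p4 : (k : ℕ) → 2 ≤ k →
  Σ (List (Subset (4 * k ∸ 1))) (λ ℬ₁ → Σ (List (Subset (4 * k ∸ 1))) (λ ℬ₂ →
    IsHadamard2Design k ℬ₁ × IsHadamard2Design k ℬ₂ × DisjointDesigns ℬ₁ ℬ₂)) →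
  Σ ℕ (λ n → Σ (Fin n → Point (4 * k ∸ 1)) (λ A → Σ (Fin n → Point (4 * k ∸ 1)) (λ B →
    IsTightPTE (4 * k ∸ 1) 1 (BinarySphere (4 * k ∸ 1) (2 * k ∸ 1)) n A B)))
proposition3p4 (suc (suc m)) (s≤s (s≤s ℕ.z≤n)) (ℬ₁ , ℬ₂ , hadamard₁ , hadamard₂ , disjoint) =
  _ , S₁.square ᵀ , S₂.square ᵀ ,
  tightPTE-of-symmetricIncidences S₁.isSymmetricIncidence S₂.isSymmetricIncidence λ′<κ columns-differ
  where
  k : ℕ
  k = 2 + m

  λ′<κ : k ∸ 1 < 2 * k ∸ 1
  λ′<κ = hadamard-λ<κ m

  1<κ : 1 < 2 * k ∸ 1
  1<κ = ℕₚ.≤-<-trans (s≤s ℕ.z≤n) λ′<κ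

  module S₁ = TwoDesign.Symmetric hadamard₁ 1<κ (hadamard-κκ≡κ+wλ m)
  module S₂ = TwoDesign.Symmetric hadamard₂ 1<κ (hadamard-κκ≡κ+wλ m)

  columns-differ : ∀ i j → ¬ (∀ x → S₁.square x i ≡ S₂.square x j)
  columns-differ i j same-column = disjoint (S₁.block i) (S₁.block∈ℬ i)
    (subst (_∈ ℬ₂) (sym (characteristic-injective same-column)) (S₂.block∈ℬ j))
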